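{- Let $S,T\in\{0,1,2\}^*$ and let $x'$ and $G'_{x'}$ be as in the context. Let $p$ be a path from $s$ to $t$ in $G'_{x'}$ such that $s,t\in 2*\overline{2}$. Then for every vertex $x'[i..j]$ visited by $p$ we have $x'[i]=2$ and $x'[j]=\overline{2}$.
   Context: Alphabet $\{0,1,2,\overline{2}\}$ (four symbols) with involution $\overline{0}=1$, $\overline{1}=0$, and $2\leftrightarrow\overline{2}$; $\overleftarrow{X}=\overline{X[|X|]}\cdots\overline{X[1]}$. For strings $a,b$, $a*b$ is the set of strings beginning with $a$ and ending with $b$. Construction of $x$: $I_L(0)=(010^3)^{55}$, $I_L(1)=(010^5)^{54}$, $I_L(2)=(010^7)^{53}$, $P_L=(010^9)^{144}$, $\mathrm{Sync}_L=01$, $I_R(\alpha)=\overleftarrow{I_L(\alpha)}$, $P_R=\overleftarrow{P_L}$, $\mathrm{Sync}_R=\overline{010}$; $E_L(\alpha)=P_L\mathrm{Sync}_LI_L(\alpha)\mathrm{Sync}_L$, $E_R(\alpha)=\mathrm{Sync}_RI_R(\alpha)\mathrm{Sync}_RP_R$; $y=P_L\,\mathrm{Sync}_L\,01\,11\overline{11}\,\overline{10}\,\mathrm{Sync}_R\,P_R$, $x=E_L(S[1])\cdots E_L(S[|S|])\,y\,E_R(T[|T|])\cdots E_R(T[1])$ (a string over $\{0,1\}$). Let $x_{\mathrm{mid}}$ be the unique index with $x[x_{\mathrm{mid}}-1..x_{\mathrm{mid}}+2]=11\overline{11}$; $x'$ has length $2|x|$ with $x'[2i-1..2i]=2\cdot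 x[i]$ for $i\le x_{\mathrm{mid}}$ and $x'[2i-1..2i]=x[i]\cdot\overline{2}$ for $i>x_{\mathrm{mid}}$. Original hairpin deletion: a string $W$ can be transformed by a right hairpin deletion of length $\ell\in[1..\lfloor|W|/2\rfloor]$ into its prefix $W'$ if $W=W'\cdot\overleftarrow{W'[1..\ell]}$ and $W'[\ell+1]=\overline{W'[|W'|]}$; by a left hairpin deletion of length $\ell$ into its suffix $W'$ if $W=\overleftarrow{W'[|W'|-\ell+1..|W'|]}\cdot W'$ and $W'[|W'|-\ell]=\overline{W'[1]}$. $G'_{x'}$: vertices are substrings $x'[i..j]$ (identified by positions), with an edge from $u$ to $v$ if $v$ is obtained from $u$ by one such (original) hairpin deletion. -}

module Defs where

open import Data.Nat using (ℕ; zero; suc; _+_; _∸_; _≤_; _<_; _/_)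
open import Data.Fin using (Fin)
import Data.Fin as F
open import Data.List using (List; []; _∷_; _++_; map; reverse; take; drop; length; replicate; concat)
open import Data.Maybe using (Maybe; just; nothing)
open import Data.Product using (Σ; ∃; _×_; _,_)
open import Data.Sum using (_⊎_)
open import Relation.Binary.PropositionalEquality using (_≡_)

data Sym : Set where
  s0 s1 s2 s2b : Sym

bar : Sym → Sym
bar s0  = s1
bar s1  = s0
bar s2  = s2b
bar s2b = s2

Str : Set
Str = List Sym

cmp : Str → Str
cmp = map bar

rc : Str → Str
rc w = reverse (map bar w)

-- 1-indexed character access (nothing if out of range, in particular at index 0)
at : Str → ℕ → Maybe Sym
at []      _             = nothing
at (c ∷ w) zero          = nothing
at (c ∷ w) (suc zero)    = just c
at (c ∷ w) (suc (suc k)) = at w (suc k)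

-- 1-indexed substring w[i..j] (meaningful when 1 ≤ i ≤ j ≤ |w|)
sub : Str → ℕ → ℕ → Str
sub w i j = take (suc (j ∸ i)) (drop (i ∸ 1) w)

pow : ℕ → Str → Str
pow n u = concat (replicate n u)

zeros : ℕ → Str
zeros k = replicate k s0

I-L : Fin 3 → Str
I-L F.zero             = pow 55 (s0 ∷ s1 ∷ zeros 3)
I-L (F.suc F.zero)     = pow 54 (s0 ∷ s1 ∷ zeros 5)
I-L (F.suc (F.suc F.zero)) = pow 53 (s0 ∷ s1 ∷ zeros 7)

P-L : Str
P-L = pow 144 (s0 ∷ s1 ∷ zeros 9)

Sync-L : Str
Sync-L = s0 ∷ s1 ∷ []

I-R : Fin 3 → Str
I-R α = rc (I-L α)

P-R : Str
P-R = rc P-L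

Sync-R : Str
Sync-R = cmp (s0 ∷ s1 ∷ s0 ∷ [])

E-L : Fin 3 → Str
E-L α = P-L ++ Sync-L ++ I-L α ++ Sync-L

E-R : Fin 3 → Str
E-R α = Sync-R ++ I-R α ++ Sync-R ++ P-R

y : Str
y = P-L ++ Sync-L ++ (s0 ∷ s1 ∷ []) ++ (s1 ∷ s1 ∷ []) ++ cmp (s1 ∷ s1 ∷ [])
      ++ cmp (s1 ∷ s0 ∷ []) ++ Sync-R ++ P-R

xStr : List (Fin 3) → List (Fin 3) → Str
xStr S T = concat (map E-L S) ++ y ++ concat (reverse (map E-R T))

-- x' from x, given x_mid = m: positions k ≤ m become 2·x[k], positions k > m become x[k]·2̄.
-- (first argument = number of remaining positions ≤ m)
prime : ℕ → Str → Str
prime _       []      = []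
prime (suc r) (c ∷ w) = s2 ∷ c ∷ prime r w
prime zero    (c ∷ w) = c ∷ s2b ∷ prime zero w

IsMid : Str → ℕ → Set
IsMid x m = (2 ≤ m) × (m + 2 ≤ length x) × (sub x (m ∸ 1) (m + 2) ≡ (s1 ∷ s1 ∷ []) ++ cmp (s1 ∷ s1 ∷ []))

RightHD : Str → Str → Set
RightHD W W' = Σ ℕ λ ℓ → (1 ≤ ℓ) × (ℓ ≤ length W / 2)
  × (W ≡ W' ++ rc (take ℓ W'))
  × (Σ Sym λ c → (at W' (length W') ≡ just c) × (at W' (suc ℓ) ≡ just (bar c)))

LeftHD : Str → Str → Set
LeftHD W W' = Σ ℕ λ ℓ → (1 ≤ ℓ) × (ℓ ≤ length W / 2)
  × (W ≡ rc (drop (length W' ∸ ℓ) W') ++ W')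
  × (Σ Sym λ c → (at W' 1 ≡ just c) × (at W' (length W' ∸ ℓ) ≡ just (bar c)))

Vertex : Set
Vertex = ℕ × ℕ

Valid : Str → Vertex → Set
Valid w (i , j) = (1 ≤ i) × (i ≤ j) × (j ≤ length w)

Edge : Str → Vertex → Vertex → Set
Edge w (i , j) (i' , j') = Valid w (i , j) × Valid w (i' , j') ×
  ( ((i' ≡ i) × RightHD (sub w i j) (sub w i j'))
  ⊎ ((j' ≡ j) × LeftHD (sub w i j) (sub w i' j)) )

data Path (E : Vertex → Vertex → Set) : Vertex → Vertex → Set where
  []  : ∀ {v} → Path E v v
  _∷_ : ∀ {u w v} → E u w → Path E w v → Path E u v

data Visits {E : Vertex → Vertex → Set} : ∀ {u v} → Path E u v → Vertex → Set where
  here  : ∀ {u v} {p : Path E u v} → Visits p u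
  there : ∀ {u w v z} {e : E u w} {p : Path E w v} → Visits p z → Visits (e ∷ p) z

InStarSet : Sym → Sym → Str → Set
InStarSet a b u = (at u 1 ≡ just a) × (at u (length u) ≡ just b)

-- Undoing a hairpin deletion only appends ←(W'[1..ℓ]) on the right, whose last letter is the
-- complement of W'[1], or prepends ←(W'[..]) on the left, whose first letter is the complement
-- of the last letter of W'.  Hence "begins with c and ends with c̄" propagates backwards along
-- every edge of G'_w, for any string w, and so from the endpoint t to every vertex of the path.
module Submission where

open import Defs
open import Data.Nat using (ℕ; zero; suc; _+_; _∸_; _≤_; _<_; s≤s)
open import Data.Nat.Properties using (m+[n∸m]≡n; m∸n≤m)
open import Data.Fin using (Fin)
open import Data.List using (List; []; _∷_; _++_; map; reverse; take; drop; length; head; last)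
open import Data.List.Properties using (unfold-reverse; reverse-involutive; head-map; last-map)
open import Data.Maybe using (just)
import Data.Maybe as Maybe
open import Data.Product using (_×_; _,_; proj₁; proj₂)
open import Data.Sum using (inj₁; inj₂)
open import Relation.Binary.PropositionalEquality using (_≡_; refl; sym; trans; cong; subst; module ≡-Reasoning)

private
  variable
    c : Sym

bar-involutive : ∀ c → bar (bar c) ≡ c
bar-involutive s0  = refl
bar-involutive s1  = refl
bar-involutive s2  = refl
bar-involutive s2b = refl

at-1 : ∀ u → at u 1 ≡ head u
at-1 []      = refl
at-1 (_ ∷ _) = refl

at-length : ∀ u → at u (length u) ≡ last u
at-length []          = refl
at-length (_ ∷ [])    = refl
at-length (_ ∷ d ∷ u) = at-length (d ∷ u)

head-++ : ∀ (xs ys : Str) → head xs ≡ just c → head (xs ++ ys) ≡ just c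
head-++ (_ ∷ _) ys h = h

last-++ : ∀ (xs ys : Str) → last ys ≡ just c → last (xs ++ ys) ≡ just c
last-++ []           ys       l = l
last-++ (_ ∷ [])     []       ()
last-++ (_ ∷ [])     (_ ∷ _)  l = l
last-++ (_ ∷ x ∷ xs) ys       l = last-++ (x ∷ xs) ys l

last-reverse : ∀ (xs : Str) → last (reverse xs) ≡ head xs
last-reverse []       = refl
last-reverse (x ∷ xs) rewrite unfold-reverse x xs = last-++ (reverse xs) (x ∷ []) refl

head-reverse : ∀ (xs : Str) → head (reverse xs) ≡ last xs
head-reverse xs = begin
  head (reverse xs)                   ≡⟨ sym (last-reverse (reverse xs)) ⟩
  last (reverse (reverse xs))         ≡⟨ cong last (reverse-involutive xs) ⟩
  last xs                             ∎
  where open ≡-Reasoning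

head-rc : ∀ w → head (rc w) ≡ Maybe.map bar (last w)
head-rc w = trans (head-reverse (map bar w)) (last-map bar w)

last-rc : ∀ w → last (rc w) ≡ Maybe.map bar (head w)
last-rc w = trans (last-reverse (map bar w)) (head-map w)

head-take-suc : ∀ k (w : Str) → head (take (suc k) w) ≡ head w
head-take-suc k []      = refl
head-take-suc k (_ ∷ _) = refl

last-drop : ∀ k (w : Str) → k < length w → last (drop k w) ≡ last w
last-drop zero    w               _         = refl
last-drop (suc k) (_ ∷ d ∷ w)     (s≤s k<n) = last-drop k (d ∷ w) k<n

head-drop : ∀ k w → head (drop k w) ≡ at w (suc k)
head-drop zero    w       = sym (at-1 w)
head-drop (suc k) []      = refl
head-drop (suc k) (_ ∷ w) = head-drop k w

last-take-drop : ∀ k n w → suc (k + n) ≤ length w →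
  last (take (suc n) (drop k w)) ≡ at w (suc (k + n))
last-take-drop zero    zero    (_ ∷ w)     _         = refl
last-take-drop zero    (suc n) (_ ∷ d ∷ w) (s≤s le) = last-take-drop zero n (d ∷ w) le
last-take-drop (suc k) n       (_ ∷ w)     (s≤s le) = last-take-drop k n w le

Bracketed : Sym → Str → Set
Bracketed c W = (head W ≡ just c) × (last W ≡ just (bar c))

RightHD-reflects-Bracketed : ∀ {W W'} → RightHD W W' → Bracketed c W' → Bracketed c W
RightHD-reflects-Bracketed {W' = W'} (suc k , _ , _ , refl , _) (h , _) =
  head-++ W' _ h ,
  last-++ W' _ (trans (last-rc (take (suc k) W')) (cong (Maybe.map bar) (trans (head-take-suc k W') h)))

LeftHD-reflects-Bracketed : ∀ {W W'} → LeftHD W W' → Bracketed c W' → Bracketed c W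
LeftHD-reflects-Bracketed {W' = d ∷ W'} (suc ℓ , _ , _ , refl , _) (_ , l) =
  head-++ (rc suffix) (d ∷ W')
    (trans (head-rc suffix) (trans (cong (Maybe.map bar) (trans (last-drop k (d ∷ W') k<n) l))
                                   (cong just (bar-involutive _)))) ,
  last-++ (rc suffix) (d ∷ W') l
  where
  k = length W' ∸ ℓ
  suffix = drop k (d ∷ W')
  k<n : k < length (d ∷ W')
  k<n = s≤s (m∸n≤m (length W') ℓ)

BracketedAt : Sym → Str → Vertex → Set
BracketedAt c w (i , j) = Valid w (i , j) × Bracketed c (sub w i j)

Edge-reflects-BracketedAt : ∀ {w u v} → Edge w u v → BracketedAt c w v → BracketedAt c w u
Edge-reflects-BracketedAt (valid-u , _ , inj₁ (refl , r)) (_ , b) = valid-u , RightHD-reflects-Bracketed r b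
Edge-reflects-BracketedAt (valid-u , _ , inj₂ (refl , l)) (_ , b) = valid-u , LeftHD-reflects-Bracketed l b

Visits-BracketedAt : ∀ {w u v z} (p : Path (Edge w) u v) →
  BracketedAt c w v → Visits p z → BracketedAt c w z
Visits-BracketedAt []      b here        = b
Visits-BracketedAt (e ∷ p) b here        = Edge-reflects-BracketedAt e (Visits-BracketedAt p b here)
Visits-BracketedAt (e ∷ p) b (there vis) = Visits-BracketedAt p b vis

BracketedAt-ends : ∀ w i j → BracketedAt c w (i , j) → (at w i ≡ just c) × (at w j ≡ just (bar c))
BracketedAt-ends w (suc i) j ((_ , i≤j , j≤n) , h , l) =
  trans (sym (head-drop i w)) (trans (sym (head-take-suc (j ∸ suc i) (drop i w))) h) ,
  subst (λ q → at w q ≡ just (bar _)) i+[j∸i]≡j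
    (trans (sym (last-take-drop i (j ∸ suc i) w (subst (_≤ length w) (sym i+[j∸i]≡j) j≤n))) l)
  where
  i+[j∸i]≡j : suc (i + (j ∸ suc i)) ≡ j
  i+[j∸i]≡j = m+[n∸m]≡n i≤j

Bracketed-from-InStarSet : ∀ W → InStarSet c (bar c) W → Bracketed c W
Bracketed-from-InStarSet W (h , l) = trans (sym (at-1 W)) h , trans (sym (at-length W)) l

lemma30 : (S T : List (Fin 3)) (m : ℕ) → IsMid (xStr S T) m →
    (s t : Vertex) → Valid (prime m (xStr S T)) s → Valid (prime m (xStr S T)) t →
    InStarSet s2 s2b (sub (prime m (xStr S T)) (proj₁ s) (proj₂ s)) →
    InStarSet s2 s2b (sub (prime m (xStr S T)) (proj₁ t) (proj₂ t)) →
    (p : Path (Edge (prime m (xStr S T))) s t) →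
    (i j : ℕ) → Visits p (i , j) →
    (at (prime m (xStr S T)) i ≡ just s2) × (at (prime m (xStr S T)) j ≡ just s2b)
lemma30 S T m _ s t _ valid-t _ t∈2*2̄ p i j visits =
  BracketedAt-ends w i j (Visits-BracketedAt p (valid-t , Bracketed-from-InStarSet _ t∈2*2̄) visits)
  where
  w = prime m (xStr S T)
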